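{- For all integers $n_1\ge2$ and $n_2\ge1$, the digraph $O_{2n_1,2n_2}$ is a transitive orientation of the graph $\overline{G'_{2n_1,2n_2}}$. In particular $\overline{G'_{2n_1,2n_2}}$ is a comparability graph.
   Context: A transitive orientation of a graph $G$ is a transitive digraph on $V(G)$ obtained by replacing each edge $\{x,y\}$ by exactly one of $(x,y),(y,x)$ (and no other arcs); a comparability graph is a graph admitting one. $\overline{G}$ is the complement of $G$; $D^\star$ is the dual of a digraph $D$ (arcs reversed). For $n\ge0$, $t_n(p)=p+n$ and $t_n(\cdot)$ shifts vertices by $n$. Put $s_2=n_1+n_2$. - $G_{2n}$: graph on $\{0,\ldots,2n-1\}$, edges $\{2i,2j+1\}$, $0\le i\le j\le n-1$. - $G'_{2n_1,2n_2}$: graph on $\{0,\ldots,2s_2-1\}$ with edges $E(G_{2n_1})\cup E(t_{2n_1}(G_{2n_2}))\cup\{\{2p-1,2q-1\}:1\le p\le n_1,\ n_1+1\le q\le s_2\}\cup\{\{2p-1,2q-1\}:1\le p<q\le n_1\}$. - $R'_{2n}$: digraph on $\{0,\ldots,2n-1\}$ with arcs $(2i,2j),(2i+1,2j)$ for $0\le i<j\le n-1$; $R_{2n}$: arcs $A(R'_{2n})\cup\{(2p+1,2q+1):0\le p<q\le n-1\}$. - $O_{2n_1,2n_2}$: digraph on $\{0,\ldots,2s_2-1\}$ with arcs $A(R'_{2n_1})\cup A(t_{2n_1}((R_{2n_2})^\star))\cup\{(2q,p):0\le p\le 2n_1-1,\ n_1\le q\le s_2-1\}\cup\{(2q+1,2p):0\le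 p\le n_1-1,\ n_1\le q\le s_2-1\}$. -}

module Defs where

open import Level using (0ℓ)
open import Data.Nat using (ℕ; _+_; _*_; _∸_; _≤_; _<_)
open import Data.Product using (Σ; ∃; ∃-syntax; _×_; _,_)
open import Data.Sum using (_⊎_)
open import Relation.Nullary using (¬_)
open import Relation.Binary.PropositionalEquality using (_≡_; _≢_)

-- Graphs: vertex set {0,…,N-1} ⊆ ℕ, given by N together with an edge
-- relation E (E x y means {x,y} is an edge; edge relations below are symmetric
-- by construction).  Digraphs: an arc relation A : ℕ → ℕ → Set.
Rel : Set₁
Rel = ℕ → ℕ → Set

Pair : ℕ → ℕ → ℕ → ℕ → Set
Pair x y a b = (x ≡ a × y ≡ b) ⊎ (x ≡ b × y ≡ a)

GE : ℕ → Rel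
GE n x y = ∃[ i ] ∃[ j ] (i ≤ j × j < n × Pair x y (2 * i) (2 * j + 1))

shiftRel : ℕ → Rel → Rel
shiftRel m R x y = ∃[ a ] ∃[ b ] (R a b × x ≡ a + m × y ≡ b + m)

G'E : ℕ → ℕ → Rel
G'E n₁ n₂ x y =
    GE n₁ x y
  ⊎ shiftRel (2 * n₁) (GE n₂) x y
  ⊎ (∃[ p ] ∃[ q ] (1 ≤ p × p ≤ n₁ × n₁ + 1 ≤ q × q ≤ n₁ + n₂
                    × Pair x y (2 * p ∸ 1) (2 * q ∸ 1)))
  ⊎ (∃[ p ] ∃[ q ] (1 ≤ p × p < q × q ≤ n₁
                    × Pair x y (2 * p ∸ 1) (2 * q ∸ 1)))

Complement : ℕ → Rel → Rel
Complement N E x y = x < N × y < N × x ≢ y × ¬ E x y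

Dual : Rel → Rel
Dual A x y = A y x

R'A : ℕ → Rel
R'A n x y = ∃[ i ] ∃[ j ] (i < j × j < n × y ≡ 2 * j × (x ≡ 2 * i ⊎ x ≡ 2 * i + 1))

RA : ℕ → Rel
RA n x y = R'A n x y ⊎ (∃[ p ] ∃[ q ] (p < q × q < n × x ≡ 2 * p + 1 × y ≡ 2 * q + 1))

OA : ℕ → ℕ → Rel
OA n₁ n₂ x y =
    R'A n₁ x y
  ⊎ shiftRel (2 * n₁) (Dual (RA n₂)) x y
  ⊎ (∃[ p ] ∃[ q ] (p ≤ 2 * n₁ ∸ 1 × n₁ ≤ q × q ≤ n₁ + n₂ ∸ 1 × x ≡ 2 * q × y ≡ p))
  ⊎ (∃[ p ] ∃[ q ] (p ≤ n₁ ∸ 1 × n₁ ≤ q × q ≤ n₁ + n₂ ∸ 1 × x ≡ 2 * q + 1 × y ≡ 2 * p))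

record IsTransitiveOrientation (E A : Rel) : Set where
  field
    oriented   : ∀ x y → E x y → A x y ⊎ A y x
    antisym    : ∀ x y → A x y → ¬ A y x
    arcsAreEdges : ∀ x y → A x y → E x y
    transitive : ∀ x y z → A x y → A y z → A x z

IsComparability : Rel → Set₁
IsComparability E = Σ Rel (λ A → IsTransitiveOrientation E A)

{-# OPTIONS --safe #-}
-- Write a vertex as 2k + b with parity b and call k its block: blocks k < n₁
-- carry G_{2n₁} and blocks n₁ ≤ k < n₁ + n₂ the shifted G_{2n₂}. In these
-- coordinates both G' and O depend only on block comparisons and parities.
-- O consists of arcs up the blocks of the first part into even vertices, arcs
-- down the blocks of the second part that never go from odd to even, and all
-- arcs from the second part to the first except odd to odd.
module Submission where

open import Defs
open import Data.Nat using (ℕ; _≤_; _+_; _*_)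
open import Data.Product using (_×_)

open import Data.Bool.Base as Bool using (Bool; true; false; f≤t; b≤b)
import Data.Bool.Properties as Bool
open import Data.Empty using (⊥-elim)
open import Data.Nat.Base using (suc; _∸_; _<_; z≤n; s≤s)
open import Data.Nat.Properties
open import Data.Nat.Tactic.RingSolver using (solve-∀)
open import Data.Product.Base using (_,_; proj₁; proj₂; map₁)
open import Data.Sum.Base as Sum using (_⊎_; inj₁; inj₂; swap)
open import Function.Base using (_on_; _∘_)
open import Relation.Binary.Core using (_⇒_; _⇔_)
open import Relation.Binary.Definitions using (Transitive; Irreflexive; Asymmetric; tri<; tri≈; tri>)
open import Relation.Binary.Consequences using (trans∧irr⇒asym)
open import Relation.Binary.Construct.Closure.Symmetric as SymClosure using (SymClosure; fwd; bwd)
open import Relation.Binary.PropositionalEquality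
open import Relation.Nullary using (¬_; yes; no)

private
  variable
    i j k m n : ℕ
    x y u v : ℕ
    b b′ : Bool

IsTransitiveOrientation-cong : ∀ {E E′ A A′ : Rel} → E ⇔ E′ → A ⇔ A′ →
  IsTransitiveOrientation E A → IsTransitiveOrientation E′ A′
IsTransitiveOrientation-cong (E⇒E′ , E′⇒E) (A⇒A′ , A′⇒A) t = record
  { oriented     = λ x y e → Sum.map A⇒A′ A⇒A′ (oriented x y (E′⇒E e))
  ; antisym      = λ x y a a′ → antisym x y (A′⇒A a) (A′⇒A a′)
  ; arcsAreEdges = λ x y a → E⇒E′ (arcsAreEdges x y (A′⇒A a))
  ; transitive   = λ x y z a a′ → A⇒A′ (transitive x y z (A′⇒A a) (A′⇒A a′))
  }
  where open IsTransitiveOrientation t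

Coord : Set
Coord = ℕ × Bool

vertex : Coord → ℕ
vertex (k , false) = 2 * k
vertex (k , true)  = 2 * k + 1

coords : ℕ → Coord
coords 0             = 0 , false
coords 1             = 0 , true
coords (suc (suc x)) = map₁ suc (coords x)

vertex-suc : ∀ c → vertex (map₁ suc c) ≡ suc (suc (vertex c))
vertex-suc (k , false) = cong suc (+-suc k (k + 0))
vertex-suc (k , true)  = cong (suc ∘ (_+ 1)) (+-suc k (k + 0))

vertex-coords : ∀ x → vertex (coords x) ≡ x
vertex-coords 0             = refl
vertex-coords 1             = refl
vertex-coords (suc (suc x)) = trans (vertex-suc (coords x)) (cong (suc ∘ suc) (vertex-coords x))

coords-vertex : ∀ c → coords (vertex c) ≡ c
coords-vertex (0 , false)     = refl
coords-vertex (0 , true)      = refl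
coords-vertex (suc k , b)     =
  trans (cong coords (vertex-suc (k , b))) (cong (map₁ suc) (coords-vertex (k , b)))

coords-injective : coords x ≡ coords y → x ≡ y
coords-injective {x} {y} eq =
  trans (sym (vertex-coords x)) (trans (cong vertex eq) (vertex-coords y))

vertex-+ : ∀ k b m → vertex (k , b) + 2 * m ≡ vertex (k + m , b)
vertex-+ k false m = sym (*-distribˡ-+ 2 k m)
vertex-+ k true  m = lemma k m
  where
  lemma : ∀ k m → 2 * k + 1 + 2 * m ≡ 2 * (k + m) + 1
  lemma = solve-∀

vertex-∸ : ∀ b → m ≤ k → vertex (k , b) ≡ vertex (k ∸ m , b) + 2 * m
vertex-∸ {m} {k} b m≤k =
  trans (cong (λ k → vertex (k , b)) (sym (m∸n+n≡m m≤k))) (sym (vertex-+ (k ∸ m) b m))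

2*suc∸1 : ∀ k → 2 * suc k ∸ 1 ≡ vertex (k , true)
2*suc∸1 k = trans (+-suc k (k + 0)) (+-comm 1 (2 * k))

vertex-< : ∀ b → k < n → vertex (k , b) < 2 * n
vertex-< false k<n = *-monoʳ-< 2 k<n
vertex-< {k} true k<n = ≤-trans (≤-reflexive (lemma k)) (*-monoʳ-≤ 2 k<n)
  where
  lemma : ∀ k → suc (2 * k + 1) ≡ 2 * suc k
  lemma = solve-∀

vertex-<⁻¹ : ∀ b → vertex (k , b) < 2 * n → k < n
vertex-<⁻¹ {k} {n} false p = *-cancelˡ-< 2 k n p
vertex-<⁻¹ {k} {n} true  p = *-cancelˡ-< 2 k n (≤-<-trans (m≤m+n (2 * k) 1) p)

coords-< : x < 2 * n → proj₁ (coords x) < n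
coords-< {x} {n} x<2n =
  vertex-<⁻¹ (proj₂ (coords x)) (subst (_< 2 * n) (sym (vertex-coords x)) x<2n)

coords-<⁻¹ : proj₁ (coords x) < n → x < 2 * n
coords-<⁻¹ {x} {n} p = subst (_< 2 * n) (vertex-coords x) (vertex-< (proj₂ (coords x)) p)

at-vertices : (R : Coord → Coord → Set) {c c′ : Coord} →
  R c c′ → x ≡ vertex c → y ≡ vertex c′ → (R on coords) x y
at-vertices R {c} {c′} r refl refl = subst₂ R (sym (coords-vertex c)) (sym (coords-vertex c′)) r

at-pair : (R : Coord → Coord → Set) {c c′ : Coord} →
  R c c′ → Pair x y (vertex c) (vertex c′) → (SymClosure R on coords) x y
at-pair R r (inj₁ (refl , refl)) = at-vertices (SymClosure R) (fwd r) refl refl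
at-pair R r (inj₂ (refl , refl)) = at-vertices (SymClosure R) (bwd r) refl refl

via-vertices : (R : Coord → Coord → Set) {Q : Rel} →
  (∀ {c c′} → R c c′ → Q (vertex c) (vertex c′)) → (R on coords) ⇒ Q
via-vertices R {Q} f {x} {y} r = subst₂ Q (vertex-coords x) (vertex-coords y) (f r)

module Blocks (n M : ℕ) where

  -- The constructors of Arc are the four families of arcs of O_{2n₁,2n₂} in
  -- order, those of Link the four families of edges of G'_{2n₁,2n₂}, the last
  -- two merged.

  data Arc : Coord → Coord → Set where
    first       : i < j → j < n → Arc (i , b) (j , false)
    second      : n ≤ j → j < i → i < M → b Bool.≤ b′ → Arc (i , b) (j , b′)
    across-even : n ≤ i → i < M → j < n → Arc (i , false) (j , b)
    across-odd  : n ≤ i → i < M → j < n → Arc (i , true) (j , false)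

  data Link : Coord → Coord → Set where
    first  : i ≤ j → j < n → Link (i , false) (j , true)
    second : n ≤ i → i ≤ j → j < M → Link (i , false) (j , true)
    odd    : i < j → i < n → j < M → Link (i , true) (j , true)

  Edge : Coord → Coord → Set
  Edge = SymClosure Link

  NonEdge : Coord → Coord → Set
  NonEdge c c′ = proj₁ c < M × proj₁ c′ < M × c ≢ c′ × ¬ Edge c c′

  arc-irrefl : Irreflexive _≡_ Arc
  arc-irrefl refl (first i<i _)           = <-irrefl refl i<i
  arc-irrefl refl (second _ i<i _ _)      = <-irrefl refl i<i
  arc-irrefl refl (across-even n≤i _ i<n) = <⇒≱ i<n n≤i

  arc-trans : Transitive Arc
  arc-trans (first i<j _)          (first j<k k<n)          = first (<-trans i<j j<k) k<n
  arc-trans (first _ j<n)          (second n≤k k<j _ _)     = ⊥-elim (<⇒≱ (<-trans k<j j<n) n≤k)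
  arc-trans (first _ j<n)          (across-even n≤j _ _)    = ⊥-elim (<⇒≱ j<n n≤j)
  arc-trans (second n≤j _ _ _)     (first j<k k<n)          = ⊥-elim (<⇒≱ (<-trans j<k k<n) n≤j)
  arc-trans (second _ j<i i<M b≤b′) (second n≤k k<j _ b′≤b″) =
    second n≤k (<-trans k<j j<i) i<M (Bool.≤-trans b≤b′ b′≤b″)
  arc-trans (second n≤j j<i i<M b≤b) (across-even _ _ k<n) =
    across-even (≤-trans n≤j (<⇒≤ j<i)) i<M k<n
  arc-trans (second n≤j j<i i<M f≤t) (across-odd _ _ k<n)  =
    across-even (≤-trans n≤j (<⇒≤ j<i)) i<M k<n
  arc-trans (second n≤j j<i i<M b≤b) (across-odd _ _ k<n)  =
    across-odd (≤-trans n≤j (<⇒≤ j<i)) i<M k<n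
  arc-trans (across-even n≤i i<M _) (first _ k<n)           = across-even n≤i i<M k<n
  arc-trans (across-even _ _ j<n)   (second n≤k k<j _ _)    = ⊥-elim (<⇒≱ (<-trans k<j j<n) n≤k)
  arc-trans (across-even _ _ j<n)   (across-even n≤j _ _)   = ⊥-elim (<⇒≱ j<n n≤j)
  arc-trans (across-even _ _ j<n)   (across-odd n≤j _ _)    = ⊥-elim (<⇒≱ j<n n≤j)
  arc-trans (across-odd n≤i i<M _)  (first _ k<n)           = across-odd n≤i i<M k<n
  arc-trans (across-odd _ _ j<n)    (second n≤k k<j _ _)    = ⊥-elim (<⇒≱ (<-trans k<j j<n) n≤k)
  arc-trans (across-odd _ _ j<n)    (across-even n≤j _ _)   = ⊥-elim (<⇒≱ j<n n≤j)

  arc-asym : Asymmetric Arc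
  arc-asym = trans∧irr⇒asym {_≈_ = _≡_} refl arc-trans arc-irrefl

  arc⇒¬edge : ∀ {c c′} → Arc c c′ → ¬ Edge c c′
  arc⇒¬edge (first i<j _)          (bwd (first j≤i _))      = <⇒≱ i<j j≤i
  arc⇒¬edge (first _ j<n)          (bwd (second n≤j _ _))   = <⇒≱ j<n n≤j
  arc⇒¬edge (second _ j<i _ _)     (fwd (first i≤j _))      = <⇒≱ j<i i≤j
  arc⇒¬edge (second _ j<i _ _)     (fwd (second _ i≤j _))   = <⇒≱ j<i i≤j
  arc⇒¬edge (second _ j<i _ _)     (fwd (odd i<j _ _))      = <-asym j<i i<j
  arc⇒¬edge (second n≤j j<i _ _)   (bwd (first _ i<n))      = <⇒≱ (<-trans j<i i<n) n≤j
  arc⇒¬edge (second _ _ _ ())      (bwd (second _ _ _))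
  arc⇒¬edge (second n≤j _ _ _)     (bwd (odd _ j<n _))      = <⇒≱ j<n n≤j
  arc⇒¬edge (across-even n≤i _ j<n) (fwd (first i≤j _))     = <⇒≱ j<n (≤-trans n≤i i≤j)
  arc⇒¬edge (across-even _ _ j<n)  (fwd (second n≤i i≤j _)) = <⇒≱ j<n (≤-trans n≤i i≤j)
  arc⇒¬edge (across-odd n≤i _ _)   (bwd (first _ i<n))      = <⇒≱ i<n n≤i
  arc⇒¬edge (across-odd _ _ j<n)   (bwd (second n≤j _ _))   = <⇒≱ j<n n≤j

  nonEdge⇔complement : ∀ {E : Rel} →
    (Edge on coords) ⇔ E → (NonEdge on coords) ⇔ Complement (2 * M) E
  nonEdge⇔complement (edge⇒E , E⇒edge) =
    (λ (k<M , k′<M , c≢c′ , ¬e) →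
      coords-<⁻¹ k<M , coords-<⁻¹ k′<M , c≢c′ ∘ cong coords , ¬e ∘ E⇒edge) ,
    (λ (x<2M , y<2M , x≢y , ¬e) →
      coords-< x<2M , coords-< y<2M , x≢y ∘ coords-injective , ¬e ∘ edge⇒E)

  module _ (n≤M : n ≤ M) where

    arc-bounded : ∀ {c c′} → Arc c c′ → proj₁ c < M × proj₁ c′ < M
    arc-bounded (first i<j j<n)        = <-≤-trans (<-trans i<j j<n) n≤M , <-≤-trans j<n n≤M
    arc-bounded (second _ j<i i<M _)   = i<M , <-trans j<i i<M
    arc-bounded (across-even _ i<M j<n) = i<M , <-≤-trans j<n n≤M
    arc-bounded (across-odd _ i<M j<n)  = i<M , <-≤-trans j<n n≤M

    arc⇒nonEdge : Arc ⇒ NonEdge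
    arc⇒nonEdge a =
      proj₁ (arc-bounded a) , proj₂ (arc-bounded a) , (λ c≡c′ → arc-irrefl c≡c′ a) , arc⇒¬edge a

    even-odd⇒arc : k < M → j < M → ¬ Edge (k , false) (j , true) →
      Arc (k , false) (j , true) ⊎ Arc (j , true) (k , false)
    even-odd⇒arc {k} {j} k<M j<M ¬e with ≤-<-connex n k | ≤-<-connex n j
    ... | inj₁ n≤k | inj₂ j<n = inj₁ (across-even n≤k k<M j<n)
    ... | inj₂ k<n | inj₁ n≤j = inj₂ (across-odd n≤j j<M k<n)
    ... | inj₂ k<n | inj₂ j<n with k ≤? j
    ...   | yes k≤j = ⊥-elim (¬e (fwd (first k≤j j<n)))
    ...   | no  k≰j = inj₂ (first (≰⇒> k≰j) k<n)
    even-odd⇒arc {k} {j} k<M j<M ¬e | inj₁ n≤k | inj₁ n≤j with k ≤? j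
    ...   | yes k≤j = ⊥-elim (¬e (fwd (second n≤k k≤j j<M)))
    ...   | no  k≰j = inj₁ (second n≤j (≰⇒> k≰j) k<M f≤t)

    nonEdge⇒arc : ∀ {c c′} → NonEdge c c′ → Arc c c′ ⊎ Arc c′ c
    nonEdge⇒arc {k , false} {j , false} (k<M , j<M , c≢c′ , _)
      with ≤-<-connex n k | ≤-<-connex n j | <-cmp k j
    ... | _        | _        | tri≈ _ refl _ = ⊥-elim (c≢c′ refl)
    ... | inj₂ _   | inj₂ j<n | tri< k<j _ _  = inj₁ (first k<j j<n)
    ... | inj₂ k<n | inj₂ _   | tri> _ _ j<k  = inj₂ (first j<k k<n)
    ... | inj₁ n≤k | inj₂ j<n | _             = inj₁ (across-even n≤k k<M j<n)
    ... | inj₂ k<n | inj₁ n≤j | _             = inj₂ (across-even n≤j j<M k<n)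
    ... | inj₁ n≤k | inj₁ _   | tri< k<j _ _  = inj₂ (second n≤k k<j j<M b≤b)
    ... | inj₁ _   | inj₁ n≤j | tri> _ _ j<k  = inj₁ (second n≤j j<k k<M b≤b)
    nonEdge⇒arc {k , false} {j , true} (k<M , j<M , _ , ¬e) = even-odd⇒arc k<M j<M ¬e
    nonEdge⇒arc {k , true} {j , false} (k<M , j<M , _ , ¬e) =
      swap (even-odd⇒arc j<M k<M (¬e ∘ SymClosure.symmetric Link))
    nonEdge⇒arc {k , true} {j , true} (k<M , j<M , c≢c′ , ¬e) with <-cmp k j
    ... | tri≈ _ refl _ = ⊥-elim (c≢c′ refl)
    ... | tri< k<j _ _  = inj₂ (second (≮⇒≥ λ k<n → ¬e (fwd (odd k<j k<n j<M))) k<j j<M b≤b)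
    ... | tri> _ _ j<k  = inj₁ (second (≮⇒≥ λ j<n → ¬e (bwd (odd j<k j<n k<M))) j<k k<M b≤b)

    isTransitiveOrientation : IsTransitiveOrientation (NonEdge on coords) (Arc on coords)
    isTransitiveOrientation = record
      { oriented     = λ _ _ → nonEdge⇒arc
      ; antisym      = λ _ _ → arc-asym
      ; arcsAreEdges = λ _ _ → arc⇒nonEdge
      ; transitive   = λ _ _ _ → arc-trans
      }

≤∸1⇒< : 1 ≤ n → m ≤ n ∸ 1 → m < n
≤∸1⇒< {suc _} _ = s≤s

<⇒≤∸1 : m < n → m ≤ n ∸ 1
<⇒≤∸1 (s≤s m≤n) = m≤n

Pair-sym : Pair x y u v → Pair y x u v
Pair-sym (inj₁ (x≡u , y≡v)) = inj₂ (y≡v , x≡u)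
Pair-sym (inj₂ (x≡v , y≡u)) = inj₁ (y≡u , x≡v)

Pair-+ : ∀ m → Pair x y u v → Pair (x + m) (y + m) (u + m) (v + m)
Pair-+ m (inj₁ (refl , refl)) = inj₁ (refl , refl)
Pair-+ m (inj₂ (refl , refl)) = inj₂ (refl , refl)

GE-sym : GE n x y → GE n y x
GE-sym (i , j , i≤j , j<n , p) = i , j , i≤j , j<n , Pair-sym p

odd-Pair : ∀ i j →
  Pair (vertex (i , true)) (vertex (j , true)) (2 * suc i ∸ 1) (2 * suc j ∸ 1)
odd-Pair i j = inj₁ (sym (2*suc∸1 i) , sym (2*suc∸1 j))

R'A-vertices : ∀ b → i < j → j < n → R'A n (vertex (i , b)) (vertex (j , false))
R'A-vertices false i<j j<n = _ , _ , i<j , j<n , refl , inj₁ refl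
R'A-vertices true  i<j j<n = _ , _ , i<j , j<n , refl , inj₂ refl

RA-vertices : i < j → j < n → b Bool.≤ b′ → RA n (vertex (i , b′)) (vertex (j , b))
RA-vertices i<j j<n f≤t           = inj₁ (R'A-vertices true i<j j<n)
RA-vertices i<j j<n (b≤b {false}) = inj₁ (R'A-vertices false i<j j<n)
RA-vertices i<j j<n (b≤b {true})  = inj₂ (_ , _ , i<j , j<n , refl , refl)

-- With n₁ = 0 the bound p ≤ 2 * n₁ ∸ 1 in O admits p = 0 and O gets the loop
-- (0, 0); 1 ≤ n₁ is all the translation needs, and n₂ is unconstrained.
module _ (n₁ n₂ : ℕ) (1≤n₁ : 1 ≤ n₁) where

  open Blocks n₁ (n₁ + n₂)

  n₁≤M : n₁ ≤ n₁ + n₂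
  n₁≤M = m≤m+n n₁ n₂

  1≤M : 1 ≤ n₁ + n₂
  1≤M = ≤-trans 1≤n₁ n₁≤M

  1≤2n₁ : 1 ≤ 2 * n₁
  1≤2n₁ = ≤-trans 1≤n₁ (m≤n*m n₁ 2)

  shift-< : j < n₂ → j + n₁ < n₁ + n₂
  shift-< {j} j<n₂ = subst (_< n₁ + n₂) (+-comm n₁ j) (+-monoʳ-< n₁ j<n₂)

  unshift-< : k < n₁ + n₂ → n₁ ≤ k → k ∸ n₁ < n₂
  unshift-< {k} k<M n₁≤k = subst (k ∸ n₁ <_) (m+n∸m≡n n₁ n₂) (∸-monoˡ-< k<M n₁≤k)

  arc⇒OA : ∀ {c c′} → Arc c c′ → OA n₁ n₂ (vertex c) (vertex c′)
  arc⇒OA {_ , b} (first i<j j<n₁) = inj₁ (R'A-vertices b i<j j<n₁)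
  arc⇒OA {i , b} {j , b′} (second n₁≤j j<i i<M b≤b′) =
    inj₂ (inj₁ (vertex (i ∸ n₁ , b) , vertex (j ∸ n₁ , b′) ,
      RA-vertices (∸-monoˡ-< j<i n₁≤j) (unshift-< i<M n₁≤i) b≤b′ ,
      vertex-∸ b n₁≤i , vertex-∸ b′ n₁≤j))
    where
    n₁≤i : n₁ ≤ i
    n₁≤i = ≤-trans n₁≤j (<⇒≤ j<i)
  arc⇒OA {_} {_ , b} (across-even n₁≤i i<M j<n₁) =
    inj₂ (inj₂ (inj₁ (_ , _ , <⇒≤∸1 (vertex-< b j<n₁) , n₁≤i , <⇒≤∸1 i<M , refl , refl)))
  arc⇒OA (across-odd n₁≤i i<M j<n₁) =
    inj₂ (inj₂ (inj₂ (_ , _ , <⇒≤∸1 j<n₁ , n₁≤i , <⇒≤∸1 i<M , refl , refl)))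

  shifted-second : i < j → j < n₂ → b Bool.≤ b′ →
    (Arc on coords) (vertex (j , b) + 2 * n₁) (vertex (i , b′) + 2 * n₁)
  shifted-second {i} {j} {b} {b′} i<j j<n₂ b≤b′ =
    at-vertices Arc (second (m≤n+m n₁ i) (+-monoˡ-< n₁ i<j) (shift-< j<n₂) b≤b′)
      (vertex-+ j b n₁) (vertex-+ i b′ n₁)

  OA⇒arc : OA n₁ n₂ ⇒ (Arc on coords)
  OA⇒arc (inj₁ (i , j , i<j , j<n₁ , refl , inj₁ refl)) =
    at-vertices Arc (first {b = false} i<j j<n₁) refl refl
  OA⇒arc (inj₁ (i , j , i<j , j<n₁ , refl , inj₂ refl)) =
    at-vertices Arc (first {b = true} i<j j<n₁) refl refl
  OA⇒arc (inj₂ (inj₁ (_ , _ , inj₁ (_ , _ , i<j , j<n₂ , refl , inj₁ refl) , refl , refl))) =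
    shifted-second i<j j<n₂ (b≤b {false})
  OA⇒arc (inj₂ (inj₁ (_ , _ , inj₁ (_ , _ , i<j , j<n₂ , refl , inj₂ refl) , refl , refl))) =
    shifted-second i<j j<n₂ f≤t
  OA⇒arc (inj₂ (inj₁ (_ , _ , inj₂ (_ , _ , i<j , j<n₂ , refl , refl) , refl , refl))) =
    shifted-second i<j j<n₂ (b≤b {true})
  OA⇒arc (inj₂ (inj₂ (inj₁ (p , _ , p≤2n₁∸1 , n₁≤q , q≤M∸1 , refl , refl)))) =
    at-vertices Arc
      (across-even {b = proj₂ (coords p)} n₁≤q (≤∸1⇒< 1≤M q≤M∸1)
        (coords-< (≤∸1⇒< 1≤2n₁ p≤2n₁∸1)))
      refl (sym (vertex-coords p))
  OA⇒arc (inj₂ (inj₂ (inj₂ (_ , _ , p≤n₁∸1 , n₁≤q , q≤M∸1 , refl , refl)))) =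
    at-vertices Arc (across-odd n₁≤q (≤∸1⇒< 1≤M q≤M∸1) (≤∸1⇒< 1≤n₁ p≤n₁∸1)) refl refl

  G'E-sym : G'E n₁ n₂ x y → G'E n₁ n₂ y x
  G'E-sym (inj₁ e) = inj₁ (GE-sym e)
  G'E-sym (inj₂ (inj₁ (a , b , e , x≡ , y≡))) = inj₂ (inj₁ (b , a , GE-sym e , y≡ , x≡))
  G'E-sym (inj₂ (inj₂ (inj₁ (p , q , 1≤p , p≤n₁ , n₁+1≤q , q≤M , e)))) =
    inj₂ (inj₂ (inj₁ (p , q , 1≤p , p≤n₁ , n₁+1≤q , q≤M , Pair-sym e)))
  G'E-sym (inj₂ (inj₂ (inj₂ (p , q , 1≤p , p<q , q≤n₁ , e)))) =
    inj₂ (inj₂ (inj₂ (p , q , 1≤p , p<q , q≤n₁ , Pair-sym e)))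

  link⇒G'E : ∀ {c c′} → Link c c′ → G'E n₁ n₂ (vertex c) (vertex c′)
  link⇒G'E (first i≤j j<n₁) = inj₁ (_ , _ , i≤j , j<n₁ , inj₁ (refl , refl))
  link⇒G'E {i , _} {j , _} (second n₁≤i i≤j j<M) =
    inj₂ (inj₁ (_ , _ ,
      (i ∸ n₁ , j ∸ n₁ , ∸-monoˡ-≤ n₁ i≤j , unshift-< j<M n₁≤j , inj₁ (refl , refl)) ,
      vertex-∸ false n₁≤i , vertex-∸ true n₁≤j))
    where
    n₁≤j : n₁ ≤ j
    n₁≤j = ≤-trans n₁≤i i≤j
  link⇒G'E {i , _} {j , _} (odd i<j i<n₁ j<M) with ≤-<-connex n₁ j
  ... | inj₁ n₁≤j = inj₂ (inj₂ (inj₁ (suc i , suc j , s≤s z≤n , i<n₁ ,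
          subst (_≤ suc j) (+-comm 1 n₁) (s≤s n₁≤j) , j<M , odd-Pair i j)))
  ... | inj₂ j<n₁ = inj₂ (inj₂ (inj₂ (suc i , suc j , s≤s z≤n , s≤s i<j , j<n₁ , odd-Pair i j)))

  edge⇒G'E : ∀ {c c′} → Edge c c′ → G'E n₁ n₂ (vertex c) (vertex c′)
  edge⇒G'E (fwd l) = link⇒G'E l
  edge⇒G'E (bwd l) = G'E-sym (link⇒G'E l)

  odd-edge : ∀ {p q} → 1 ≤ p → p < q → p ≤ n₁ → q ≤ n₁ + n₂ →
    Pair x y (2 * p ∸ 1) (2 * q ∸ 1) → (Edge on coords) x y
  odd-edge {p = suc p} {suc q} (s≤s z≤n) (s≤s p<q) p<n₁ q<M e =
    at-pair Link (odd p<q p<n₁ q<M) (subst₂ (Pair _ _) (2*suc∸1 p) (2*suc∸1 q) e)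

  G'E⇒edge : G'E n₁ n₂ ⇒ (Edge on coords)
  G'E⇒edge (inj₁ (_ , _ , i≤j , j<n₁ , e)) = at-pair Link (first i≤j j<n₁) e
  G'E⇒edge (inj₂ (inj₁ (_ , _ , (i , j , i≤j , j<n₂ , e) , refl , refl))) =
    at-pair Link (second (m≤n+m n₁ i) (+-monoˡ-≤ n₁ i≤j) (shift-< j<n₂))
      (subst₂ (Pair _ _) (vertex-+ i false n₁) (vertex-+ j true n₁) (Pair-+ (2 * n₁) e))
  G'E⇒edge (inj₂ (inj₂ (inj₁ (_ , q , 1≤p , p≤n₁ , n₁+1≤q , q≤M , e)))) =
    odd-edge 1≤p (≤-<-trans p≤n₁ (subst (_≤ q) (+-comm n₁ 1) n₁+1≤q)) p≤n₁ q≤M e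
  G'E⇒edge (inj₂ (inj₂ (inj₂ (_ , _ , 1≤p , p<q , q≤n₁ , e)))) =
    odd-edge 1≤p p<q (<⇒≤ (<-≤-trans p<q q≤n₁)) (≤-trans q≤n₁ n₁≤M) e

  O-isTransitiveOrientation :
    IsTransitiveOrientation (Complement (2 * (n₁ + n₂)) (G'E n₁ n₂)) (OA n₁ n₂)
  O-isTransitiveOrientation =
    IsTransitiveOrientation-cong
      (nonEdge⇔complement (via-vertices Edge edge⇒G'E , G'E⇒edge))
      (via-vertices Arc arc⇒OA , OA⇒arc)
      (isTransitiveOrientation n₁≤M)

mainTheorem9 : (n₁ n₂ : ℕ) → 2 ≤ n₁ → 1 ≤ n₂ →
    IsTransitiveOrientation (Complement (2 * (n₁ + n₂)) (G'E n₁ n₂)) (OA n₁ n₂)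
    × IsComparability (Complement (2 * (n₁ + n₂)) (G'E n₁ n₂))
mainTheorem9 n₁ n₂ 2≤n₁ _ = orientation , (OA n₁ n₂ , orientation)
  where
  orientation : IsTransitiveOrientation (Complement (2 * (n₁ + n₂)) (G'E n₁ n₂)) (OA n₁ n₂)
  orientation = O-isTransitiveOrientation n₁ n₂ (≤-trans (s≤s z≤n) 2≤n₁)
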